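{- Let $\gamma$ be a column and $w\in A^*$. Then $w\cdot\gamma$ is the first column of the tableau $P(w\,r(\gamma))$, which is the tableau obtained by Schensted row insertion of the word $r(\gamma)$ into $P(w)$.
   Context: $A$ is a finite totally ordered alphabet. A column is a subset of $A$; $r(\gamma)$ denotes the strictly decreasing word of its elements. For a column $\gamma$ and a letter $x$: if $x>y$ for all $y\in\gamma$, $x\cdot\gamma=\gamma\cup\{x\}$; otherwise with $y$ the smallest element of $\gamma$ with $y\geq x$, $x\cdot\gamma=(\gamma\setminus\{y\})\cup\{x\}$; this extends to a left action of $A^*$ on columns by $(uv)\cdot\gamma=u\cdot(v\cdot\gamma)$. $P(w)$ is the semistandard Young tableau obtained from $w$ by Schensted row insertion (rows weakly increasing, columns strictly increasing); its first column is its leftmost column, viewed as a set of letters. -}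

module Defs where

open import Data.Nat using (ℕ)
open import Data.Fin using (Fin; _<?_; _≤?_)
open import Data.Fin.Subset using (Subset; ⁅_⁆; _∪_; _-_; ⊥)
open import Data.Fin.Subset.Properties using (_∈?_)
open import Data.List using (List; []; _∷_; filter; reverse; foldr; foldl; allFin; _++_; [_])
open import Data.Maybe using (Maybe; just; nothing)
open import Data.Product using (_×_; _,_)
open import Relation.Nullary using (yes; no)
open import Relation.Nullary.Decidable using (_×-dec_)

Word : ℕ → Set
Word n = List (Fin n)

Column : ℕ → Set
Column n = Subset n

elemsInc : ∀ {n} → Column n → List (Fin n)
elemsInc γ = filter (λ y → y ∈? γ) (allFin _)

r : ∀ {n} → Column n → Word n
r γ = reverse (elemsInc γ)

smallestGeq : ∀ {n} → Fin n → Column n → Maybe (Fin n)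
smallestGeq x γ with filter (λ y → (y ∈? γ) ×-dec (x ≤? y)) (allFin _)
... | []    = nothing
... | y ∷ _ = just y

act : ∀ {n} → Fin n → Column n → Column n
act x γ with smallestGeq x γ
... | nothing = γ ∪ ⁅ x ⁆
... | just y  = (γ - y) ∪ ⁅ x ⁆

-- Left action of words: (uv)·γ = u·(v·γ), i.e. (x₁…x_k)·γ = x₁·(…(x_k·γ)).
_·_ : ∀ {n} → Word n → Column n → Column n
w · γ = foldr act γ w

-- Tableaux: list of rows (top row first), each row a weakly increasing list.
Row : ℕ → Set
Row n = List (Fin n)

Tableau : ℕ → Set
Tableau n = List (Row n)

rowBump : ∀ {n} → Fin n → Row n → Maybe (Fin n) × Row n
rowBump x [] = nothing , [ x ]
rowBump x (y ∷ ys) with x <? y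
... | yes _ = just y , x ∷ ys
... | no _ with rowBump x ys
...   | b , ys' = b , y ∷ ys'

insert : ∀ {n} → Fin n → Tableau n → Tableau n
insert x [] = [ [ x ] ]
insert x (row ∷ rows) with rowBump x row
... | nothing , row' = row' ∷ rows
... | just y  , row' = row' ∷ insert y rows

insertWord : ∀ {n} → Word n → Tableau n → Tableau n
insertWord w T = foldl (λ T' x → insert x T') T w

P : ∀ {n} → Word n → Tableau n
P w = insertWord w []

firstColumn : ∀ {n} → Tableau n → Column n
firstColumn [] = ⊥
firstColumn ([] ∷ rows) = firstColumn rows
firstColumn ((x ∷ _) ∷ rows) = ⁅ x ⁆ ∪ firstColumn rows

-- Keep a column as the increasing list of its letters: x replaces the first entry ≥ x, or
-- is appended. Call two words equivalent when they act identically on every column. The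
-- action satisfies the Knuth relations yzx ∼ yxz (x < y ≤ z) and xzy ∼ zxy (x ≤ y < z), and
-- each Schensted row insertion is a composite of them, so w ∼ reading (P w). The reading word
-- of a tableau whose first column is strictly increasing builds exactly that column from the
-- empty one, and r(γ) builds γ; hence w · γ = (w r(γ)) · ∅ is the first column of P(w r(γ)).
module Submission where

open import Defs
open import Level using (_⊔_)
open import Data.Nat using (ℕ)
-- The orders on Fin n are those of ℕ on toℕ, so Data.Nat.Properties applies verbatim.
open import Data.Nat.Properties
  using (≤-refl; ≤-trans; <-trans; ≤-<-trans; <-≤-trans; <⇒≤; ≤⇒≯; ≰⇒>; <-irrefl)
open import Data.Fin using (Fin; zero; suc; _<_; _≤_; _<?_; _≤?_)
open import Data.Fin.Subset using (Subset; ⁅_⁆; _∪_; _-_; ⊥)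
  renaming (_∈_ to _∈ₛ_)
open import Data.Fin.Subset.Properties
  using (_∈?_; ⊆-antisym; x∈p∪q⁻; x∈p∪q⁺; x∈⁅x⁆; x∈⁅y⁆⇒x≡y; ∉⊥; p─q⊆p; x∈p∧x≢y⇒x∈p-y)
open import Data.List using (List; []; _∷_; _++_; [_]; foldr; filter; reverse; allFin)
open import Data.List.Properties using (foldr-++; foldl-++; ++-assoc; ++-identityʳ; unfold-reverse;
  filter-none; filter-accept; filter-reject)
open import Data.List.Relation.Unary.All as All using (All; []; _∷_)
open import Data.List.Relation.Unary.All.Properties using (¬Any⇒All¬; ++⁻ˡ; ++⁻ʳ; ++⁻; ++⁺)
open import Data.List.Relation.Unary.Any as Any using (Any; here; there; any?)
open import Data.List.Relation.Unary.AllPairs using (AllPairs; []; _∷_)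
import Data.List.Relation.Unary.AllPairs.Properties as AllPairs
open import Data.List.Membership.Propositional using (_∈_; _∉_)
open import Data.List.Membership.Propositional.Properties
  using (∈-++⁺ˡ; ∈-++⁺ʳ; ∈-++⁻; ∈-filter⁺; ∈-filter⁻; ∈-allFin)
import Data.Vec as Vec
open import Data.Maybe using (just; nothing)
open import Data.Product using (_×_; _,_; proj₂; ∃)
open import Data.Sum using (_⊎_; inj₁; inj₂; swap)
open import Data.Unit using (⊤)
open import Function using (_∘_)
open import Relation.Binary.Core using (Rel)
open import Relation.Nullary using (¬_; yes; no; contradiction)
open import Relation.Nullary.Decidable using (_×-dec_)
open import Relation.Unary using (Decidable)
open import Relation.Binary.PropositionalEquality
  using (_≡_; _≢_; refl; sym; trans; cong; subst; module ≡-Reasoning)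
import Relation.Binary.Reasoning.Base.Single as SingleReasoning

private
  variable
    n : ℕ
    x y z b a : Fin n
    c p q t u v R : List (Fin n)
    T : Tableau n
    S : Subset n

≤-or-> : (x y : Fin n) → x ≤ y ⊎ y < x
≤-or-> x y with x ≤? y
... | yes x≤y = inj₁ x≤y
... | no  x≰y = inj₂ (≰⇒> x≰y)

Increasing : List (Fin n) → Set
Increasing = AllPairs _<_

WeaklyIncreasing : List (Fin n) → Set
WeaklyIncreasing = AllPairs _≤_

allPairs-++⁻ : ∀ {a ℓ} {A : Set a} {_~_ : Rel A ℓ} (p : List A) {q} → AllPairs _~_ (p ++ q) →
               AllPairs _~_ p × AllPairs _~_ q × All (λ e → All (e ~_) q) p
allPairs-++⁻ []      pq~           = [] , pq~ , []
allPairs-++⁻ (_ ∷ p) (h~pq ∷ pq~) with allPairs-++⁻ p pq~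
... | p~ , q~ , p~q = ++⁻ˡ p h~pq ∷ p~ , q~ , ++⁻ʳ p h~pq ∷ p~q

All-replace : ∀ {a ℓ} {A : Set a} {P : A → Set ℓ} (p : List A) {x y q} →
              All P (p ++ y ∷ q) → P x → All P (p ++ x ∷ q)
All-replace p Ppyq Px with ++⁻ p Ppyq
... | Pp , _ ∷ Pq = ++⁺ Pp (Px ∷ Pq)

allFin-increasing : Increasing (allFin n)
allFin-increasing = AllPairs.tabulate⁺-< (λ i<j → i<j)

data Split {a ℓ} {A : Set a} (P Q : A → Set ℓ) (c : List A) : Set (a ⊔ ℓ) where
  all : All P c → Split P Q c
  at  : ∀ p y q → c ≡ p ++ y ∷ q → All P p → Q y → Split P Q c

split : ∀ {a ℓ} {A : Set a} {P Q : A → Set ℓ} → (∀ y → P y ⊎ Q y) → ∀ c → Split P Q c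
split P⊎Q [] = all []
split P⊎Q (h ∷ c) with P⊎Q h | split P⊎Q c
... | inj₂ Qh | _               = at [] h c refl [] Qh
... | inj₁ Ph | all Pc          = all (Ph ∷ Pc)
... | inj₁ Ph | at p y q eq Pp Qy = at (h ∷ p) y q (cong (h ∷_) eq) (Ph ∷ Pp) Qy

-- The column action on increasing lists

actList : Fin n → List (Fin n) → List (Fin n)
actList x [] = [ x ]
actList x (h ∷ c) with x ≤? h
... | yes _ = x ∷ c
... | no  _ = h ∷ actList x c

infixr 5 _·ₗ_
_·ₗ_ : Word n → List (Fin n) → List (Fin n)
w ·ₗ c = foldr actList c w

·ₗ-++ : ∀ u → (u ++ v) ·ₗ c ≡ u ·ₗ (v ·ₗ c)
·ₗ-++ {v = v} {c = c} u = foldr-++ actList c u v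

actList-≤ : x ≤ y → actList x (y ∷ c) ≡ x ∷ c
actList-≤ {x = x} {y} x≤y with x ≤? y
... | yes _   = refl
... | no  x≰y = contradiction x≤y x≰y

actList-> : y < x → actList x (y ∷ c) ≡ y ∷ actList x c
actList-> {y = y} {x} y<x with x ≤? y
... | yes x≤y = contradiction y<x (≤⇒≯ x≤y)
... | no  _   = refl

actList-append : All (_< x) c → actList x c ≡ c ++ [ x ]
actList-append []          = refl
actList-append (h<x ∷ c<x) = trans (actList-> h<x) (cong (_ ∷_) (actList-append c<x))

actList-replace : ∀ p → All (_< x) p → x ≤ y → actList x (p ++ y ∷ q) ≡ p ++ x ∷ q
actList-replace []      []          x≤y = actList-≤ x≤y
actList-replace (_ ∷ p) (h<x ∷ p<x) x≤y =
  trans (actList-> h<x) (cong (_ ∷_) (actList-replace p p<x x≤y))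

actList-All : ∀ {P : Fin n → Set} → P x → All P c → All P (actList x c)
actList-All                     Px []        = Px ∷ []
actList-All {x = x} {c = h ∷ c} Px (Ph ∷ Pc) with x ≤? h
... | yes _ = Px ∷ Pc
... | no  _ = Ph ∷ actList-All Px Pc

actList-Any : ∀ {P : Fin n → Set} → P x → Any P (actList x c)
actList-Any {c = []}            Px = here Px
actList-Any {x = x} {c = h ∷ c} Px with x ≤? h
... | yes _ = here Px
... | no  _ = there (actList-Any {c = c} Px)

actList-increasing : Increasing c → Increasing (actList x c)
actList-increasing                 []           = [] ∷ []
actList-increasing {c = h ∷ c} {x = x} (h<c ∷ c↑) with x ≤? h
... | yes x≤h = All.map (≤-<-trans x≤h) h<c ∷ c↑
... | no  x≰h = actList-All (≰⇒> x≰h) h<c ∷ actList-increasing c↑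

·ₗ-increasing : ∀ w → Increasing c → Increasing (w ·ₗ c)
·ₗ-increasing []      c↑ = c↑
·ₗ-increasing (x ∷ w) c↑ = actList-increasing (·ₗ-increasing w c↑)

-- Commutation of letters, and the Knuth relations

Between : Fin n → Fin n → Fin n → Set
Between x z e = x ≤ e × e < z

actList-comm-head : x ≤ y → y < z →
                    actList x (actList z (y ∷ c)) ≡ actList z (actList x (y ∷ c))
actList-comm-head {x = x} {y} {z} {c} x≤y y<z = begin
  actList x (actList z (y ∷ c)) ≡⟨ cong (actList x) (actList-> y<z) ⟩
  actList x (y ∷ actList z c)   ≡⟨ actList-≤ x≤y ⟩
  x ∷ actList z c               ≡⟨ actList-> (≤-<-trans x≤y y<z) ⟨
  actList z (x ∷ c)             ≡⟨ cong (actList z) (actList-≤ x≤y) ⟨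
  actList z (actList x (y ∷ c)) ∎
  where open ≡-Reasoning

actList-comm-tail : y < x → y < z → actList x (actList z c) ≡ actList z (actList x c) →
                    actList x (actList z (y ∷ c)) ≡ actList z (actList x (y ∷ c))
actList-comm-tail {y = y} {x} {z} {c} y<x y<z comm = begin
  actList x (actList z (y ∷ c)) ≡⟨ cong (actList x) (actList-> y<z) ⟩
  actList x (y ∷ actList z c)   ≡⟨ actList-> y<x ⟩
  y ∷ actList x (actList z c)   ≡⟨ cong (y ∷_) comm ⟩
  y ∷ actList z (actList x c)   ≡⟨ actList-> y<z ⟨
  actList z (y ∷ actList x c)   ≡⟨ cong (actList z) (actList-> y<x) ⟨
  actList z (actList x (y ∷ c)) ∎
  where open ≡-Reasoning

-- x and z move different entries as soon as some entry lies in [x, z).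
actList-comm : Increasing c → Any (Between x z) c →
               actList x (actList z c) ≡ actList z (actList x c)
actList-comm _ (here (x≤h , h<z)) = actList-comm-head x≤h h<z
actList-comm {c = h ∷ c} {x = x} {z = z} (h<c ∷ c↑) (there w) with ≤-or-> x h
... | inj₁ x≤h with All.lookupAny h<c w
...   | h<e , _ , e<z = actList-comm-head x≤h (<-trans h<e e<z)
actList-comm {c = h ∷ c} {x = x} {z = z} (h<c ∷ c↑) (there w) | inj₂ h<x =
  actList-comm-tail h<x (<-trans h<x (x<z w)) (actList-comm c↑ w)
  where
  x<z : Any (Between x z) c → x < z
  x<z w with Any.satisfied w
  ... | _ , x≤e , e<z = ≤-<-trans x≤e e<z

-- With no entry in [x, z), z lands where x would, and x then overwrites it.
actList-absorb : x ≤ z → All (¬_ ∘ Between x z) c → actList x (actList z c) ≡ actList x c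
actList-absorb x≤z [] = actList-≤ x≤z
actList-absorb {x = x} {z} {h ∷ c} x≤z (h∉ ∷ c∉) with ≤-or-> z h
... | inj₁ z≤h = begin
  actList x (actList z (h ∷ c)) ≡⟨ cong (actList x) (actList-≤ z≤h) ⟩
  actList x (z ∷ c)             ≡⟨ actList-≤ x≤z ⟩
  x ∷ c                         ≡⟨ actList-≤ (≤-trans x≤z z≤h) ⟨
  actList x (h ∷ c)             ∎
  where open ≡-Reasoning
... | inj₂ h<z = begin
  actList x (actList z (h ∷ c)) ≡⟨ cong (actList x) (actList-> h<z) ⟩
  actList x (h ∷ actList z c)   ≡⟨ actList-> h<x ⟩
  h ∷ actList x (actList z c)   ≡⟨ cong (h ∷_) (actList-absorb x≤z c∉) ⟩
  h ∷ actList x c               ≡⟨ actList-> h<x ⟨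
  actList x (h ∷ c)             ∎
  where
  open ≡-Reasoning
  h<x : h < x
  h<x with ≤-or-> x h
  ... | inj₁ x≤h = contradiction (x≤h , h<z) h∉
  ... | inj₂ h<x = h<x

actList-knuth₁ : x < y → y ≤ z → Increasing c →
                 actList y (actList z (actList x c)) ≡ actList y (actList x (actList z c))
actList-knuth₁ {x = x} {y} {z} {c} x<y y≤z c↑
  with any? (λ e → (x ≤? e) ×-dec (e <? z)) c
... | yes w  = cong (actList y) (sym (actList-comm c↑ w))
... | no  ¬w = trans (actList-absorb y≤z xc∉) (cong (actList y) (sym (actList-absorb x≤z c∉)))
  where
  x≤z = <⇒≤ (<-≤-trans x<y y≤z)
  c∉ = ¬Any⇒All¬ c ¬w
  xc∉ : All (¬_ ∘ Between y z) (actList x c)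
  xc∉ = actList-All (λ (y≤x , _) → ≤⇒≯ y≤x x<y)
                    (All.map (λ ∉ (y≤e , e<z) → ∉ (≤-trans (<⇒≤ x<y) y≤e , e<z)) c∉)

actList-knuth₂ : x ≤ y → y < z → Increasing c →
                 actList x (actList z (actList y c)) ≡ actList z (actList x (actList y c))
actList-knuth₂ {c = c} x≤y y<z c↑ =
  actList-comm (actList-increasing c↑) (actList-Any {c = c} (x≤y , y<z))

-- Words acting identically on all columns

infix 4 _∼_
record _∼_ (u v : Word n) : Set where
  field same-action : ∀ {c} → Increasing c → u ·ₗ c ≡ v ·ₗ c
open _∼_

∼-refl : u ∼ u
∼-refl = record { same-action = λ _ → refl }

∼-reflexive : u ≡ v → u ∼ v
∼-reflexive refl = ∼-refl

∼-trans : u ∼ v → v ∼ t → u ∼ t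
∼-trans u∼v v∼t =
  record { same-action = λ c↑ → trans (same-action u∼v c↑) (same-action v∼t c↑) }

module ∼-Reasoning {n} = SingleReasoning (_∼_ {n}) ∼-refl ∼-trans

++-congˡ : ∀ p → u ∼ v → p ++ u ∼ p ++ v
++-congˡ {u = u} {v} p u∼v = record { same-action = λ {c} c↑ → begin
  (p ++ u) ·ₗ c  ≡⟨ ·ₗ-++ p ⟩
  p ·ₗ (u ·ₗ c)  ≡⟨ cong (p ·ₗ_) (same-action u∼v c↑) ⟩
  p ·ₗ (v ·ₗ c)  ≡⟨ ·ₗ-++ p ⟨
  (p ++ v) ·ₗ c  ∎ }
  where open ≡-Reasoning

++-congʳ : ∀ t → u ∼ v → u ++ t ∼ v ++ t
++-congʳ {u = u} {v} t u∼v = record { same-action = λ {c} c↑ → begin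
  (u ++ t) ·ₗ c  ≡⟨ ·ₗ-++ u ⟩
  u ·ₗ (t ·ₗ c)  ≡⟨ same-action u∼v (·ₗ-increasing t c↑) ⟩
  v ·ₗ (t ·ₗ c)  ≡⟨ ·ₗ-++ v ⟨
  (v ++ t) ·ₗ c  ∎ }
  where open ≡-Reasoning

knuth₁ : x < y → y ≤ z → y ∷ z ∷ x ∷ t ∼ y ∷ x ∷ z ∷ t
knuth₁ {t = t} x<y y≤z =
  record { same-action = λ c↑ → actList-knuth₁ x<y y≤z (·ₗ-increasing t c↑) }

knuth₂ : x ≤ y → y < z → x ∷ z ∷ y ∷ t ∼ z ∷ x ∷ y ∷ t
knuth₂ {t = t} x≤y y<z =
  record { same-action = λ c↑ → actList-knuth₂ x≤y y<z (·ₗ-increasing t c↑) }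

-- Row insertion

rowBump-append : All (_≤ x) R → rowBump x R ≡ (nothing , R ++ [ x ])
rowBump-append [] = refl
rowBump-append {x = x} {R = a ∷ _} (a≤x ∷ R≤x) with x <? a
... | yes x<a = contradiction x<a (≤⇒≯ a≤x)
... | no  _ = cong (λ (bumped , R′) → bumped , a ∷ R′) (rowBump-append R≤x)

rowBump-bump : ∀ p → All (_≤ x) p → x < b → rowBump x (p ++ b ∷ q) ≡ (just b , p ++ x ∷ q)
rowBump-bump {x = x} {b} [] [] x<b with x <? b
... | yes _   = refl
... | no  x≮b = contradiction x<b x≮b
rowBump-bump {x = x} (a ∷ p) (a≤x ∷ p≤x) x<b with x <? a
... | yes x<a = contradiction x<a (≤⇒≯ a≤x)
... | no  _ = cong (λ (bumped , R′) → bumped , a ∷ R′) (rowBump-bump p p≤x x<b)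

insert-append : All (_≤ x) R → insert x (R ∷ T) ≡ (R ++ [ x ]) ∷ T
insert-append R≤x rewrite rowBump-append R≤x = refl

insert-bump : ∀ p → All (_≤ x) p → x < b → insert x ((p ++ b ∷ q) ∷ T) ≡ (p ++ x ∷ q) ∷ insert b T
insert-bump {q = q} p p≤x x<b rewrite rowBump-bump {q = q} p p≤x x<b = refl

splitRow : ∀ x → (R : List (Fin n)) → Split (_≤ x) (x <_) R
splitRow x = split (λ h → ≤-or-> h x)

sink-below-head : x < b → WeaklyIncreasing (b ∷ q) → b ∷ q ++ [ x ] ∼ b ∷ x ∷ q
sink-below-head {q = []}    x<b _ = ∼-refl
sink-below-head {b = b} {q = s ∷ q} x<b ((b≤s ∷ _) ∷ sq↑) =
  ∼-trans (++-congˡ [ b ] (sink-below-head (<-≤-trans x<b b≤s) sq↑)) (knuth₁ x<b b≤s)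

raise-past-smaller : ∀ p → All (_≤ x) p → WeaklyIncreasing p → x < b →
                     p ++ b ∷ x ∷ t ∼ b ∷ p ++ x ∷ t
raise-past-smaller []           _               _              _   = ∼-refl
raise-past-smaller (a ∷ [])     (a≤x ∷ _)       _              x<b = knuth₂ a≤x x<b
raise-past-smaller (a ∷ a′ ∷ p) (_ ∷ a′≤x ∷ p≤x) ((a≤a′ ∷ _) ∷ p↑) x<b =
  ∼-trans (++-congˡ [ a ] (raise-past-smaller (a′ ∷ p) (a′≤x ∷ p≤x) p↑ x<b))
          (knuth₂ a≤a′ (≤-<-trans a′≤x x<b))

row-insertion-∼ : ∀ p → WeaklyIncreasing (p ++ b ∷ q) → All (_≤ x) p → x < b →
                  (p ++ b ∷ q) ++ [ x ] ∼ b ∷ p ++ x ∷ q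
row-insertion-∼ {b = b} {q} {x} p pbq↑ p≤x x<b with allPairs-++⁻ p pbq↑
... | p↑ , bq↑ , _ = begin
  (p ++ b ∷ q) ++ [ x ] ≡⟨ ++-assoc p (b ∷ q) [ x ] ⟩
  p ++ b ∷ q ++ [ x ]   ∼⟨ ++-congˡ p (sink-below-head x<b bq↑) ⟩
  p ++ b ∷ x ∷ q        ∼⟨ raise-past-smaller p p≤x p↑ x<b ⟩
  b ∷ p ++ x ∷ q        ∎
  where open ∼-Reasoning

weaklyIncreasing-replace : ∀ p → WeaklyIncreasing (p ++ b ∷ q) → All (_≤ x) p → x ≤ b →
                           WeaklyIncreasing (p ++ x ∷ q)
weaklyIncreasing-replace []      (b≤q ∷ q↑)  []          x≤b = All.map (≤-trans x≤b) b≤q ∷ q↑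
weaklyIncreasing-replace (_ ∷ p) (a≤ ∷ rest↑) (a≤x ∷ p≤x) x≤b =
  All-replace p a≤ a≤x ∷ weaklyIncreasing-replace p rest↑ p≤x x≤b

reading : Tableau n → Word n
reading []      = []
reading (R ∷ T) = reading T ++ R

firstColumnList : Tableau n → List (Fin n)
firstColumnList []               = []
firstColumnList ([] ∷ T)         = firstColumnList T
firstColumnList ((a ∷ _) ∷ T)    = a ∷ firstColumnList T

data WellFormed (Above : Fin n → Set) : Tableau n → Set where
  []  : WellFormed Above []
  row : Above a → WeaklyIncreasing (a ∷ R) → WellFormed (a <_) T → WellFormed Above ((a ∷ R) ∷ T)

WellFormed-mono : ∀ {P Q : Fin n → Set} → (∀ {y} → P y → Q y) → WellFormed P T → WellFormed Q T
WellFormed-mono P⇒Q []              = []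
WellFormed-mono P⇒Q (row Pr aR↑ T⋆) = row (P⇒Q Pr) aR↑ T⋆

WellFormed⇒rows : ∀ {Above : Fin n → Set} → WellFormed Above T → All WeaklyIncreasing T
WellFormed⇒rows []             = []
WellFormed⇒rows (row _ aR↑ T⋆) = aR↑ ∷ WellFormed⇒rows T⋆

insert-wellFormed : ∀ {Above : Fin n → Set} → Above x → WellFormed Above T →
                    WellFormed Above (insert x T)
insert-wellFormed Ax [] = row Ax ([] ∷ []) []
insert-wellFormed {x = x} {T = (a ∷ R) ∷ T} Ax (row Ar aR↑ T⋆) with splitRow x (a ∷ R)
... | all aR≤x = subst (WellFormed _) (sym (insert-append aR≤x))
  (row Ar (AllPairs.++⁺ aR↑ ([] ∷ []) (All.map (_∷ []) aR≤x)) T⋆)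
... | at [] b q refl [] x<b = subst (WellFormed _) (sym (insert-bump [] [] x<b))
  (row Ax (weaklyIncreasing-replace [] aR↑ [] (<⇒≤ x<b))
          (insert-wellFormed x<b (WellFormed-mono (<-trans x<b) T⋆)))
... | at (_ ∷ p) b q refl (a≤x ∷ p≤x) x<b =
  subst (WellFormed _) (sym (insert-bump (a ∷ p) (a≤x ∷ p≤x) x<b))
  (row Ar (weaklyIncreasing-replace (a ∷ p) aR↑ (a≤x ∷ p≤x) (<⇒≤ x<b))
          (insert-wellFormed (≤-<-trans a≤x x<b) T⋆))

insertWord-wellFormed : ∀ u → WellFormed (λ _ → ⊤) T → WellFormed (λ _ → ⊤) (insertWord u T)
insertWord-wellFormed []      T⋆ = T⋆
insertWord-wellFormed (x ∷ u) T⋆ = insertWord-wellFormed u (insert-wellFormed _ T⋆)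

insert-reading : All WeaklyIncreasing T → reading T ++ [ x ] ∼ reading (insert x T)
insert-reading {T = []} _ = ∼-refl
insert-reading {T = R ∷ T} {x} (R↑ ∷ T↑) with splitRow x R
... | all R≤x = begin
  (reading T ++ R) ++ [ x ]     ≡⟨ ++-assoc (reading T) R [ x ] ⟩
  reading T ++ R ++ [ x ]       ≡⟨ cong reading (insert-append R≤x) ⟨
  reading (insert x (R ∷ T))    ∎
  where open ∼-Reasoning
... | at p b q refl p≤x x<b = begin
  (reading T ++ p ++ b ∷ q) ++ [ x ]   ≡⟨ ++-assoc (reading T) (p ++ b ∷ q) [ x ] ⟩
  reading T ++ (p ++ b ∷ q) ++ [ x ]   ∼⟨ ++-congˡ (reading T) (row-insertion-∼ p R↑ p≤x x<b) ⟩
  reading T ++ b ∷ p ++ x ∷ q          ≡⟨ ++-assoc (reading T) [ b ] (p ++ x ∷ q) ⟨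
  (reading T ++ [ b ]) ++ p ++ x ∷ q   ∼⟨ ++-congʳ (p ++ x ∷ q) (insert-reading T↑) ⟩
  reading (insert b T) ++ p ++ x ∷ q   ≡⟨ cong reading (insert-bump p p≤x x<b) ⟨
  reading (insert x ((p ++ b ∷ q) ∷ T)) ∎
  where open ∼-Reasoning

insertWord-reading : ∀ u → WellFormed (λ _ → ⊤) T → reading T ++ u ∼ reading (insertWord u T)
insertWord-reading {T = T} []      _  = ∼-reflexive (++-identityʳ (reading T))
insertWord-reading {T = T} (x ∷ u) T⋆ = begin
  reading T ++ x ∷ u                 ≡⟨ ++-assoc (reading T) [ x ] u ⟨
  (reading T ++ [ x ]) ++ u          ∼⟨ ++-congʳ u (insert-reading (WellFormed⇒rows T⋆)) ⟩
  reading (insert x T) ++ u          ∼⟨ insertWord-reading u (insert-wellFormed _ T⋆) ⟩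
  reading (insertWord u (insert x T)) ∎
  where open ∼-Reasoning

row-action : WeaklyIncreasing (a ∷ R) → All (_< a) c → (a ∷ R) ·ₗ c ≡ c ++ [ a ]
row-action {R = []}    _                 c<a = actList-append c<a
row-action {a = a} {R = s ∷ R} {c} ((a≤s ∷ _) ∷ sR↑) c<a = begin
  actList a ((s ∷ R) ·ₗ c) ≡⟨ cong (actList a) (row-action sR↑ c<s) ⟩
  actList a (c ++ [ s ])   ≡⟨ actList-replace c c<a a≤s ⟩
  c ++ [ a ]               ∎
  where
  open ≡-Reasoning
  c<s = All.map (λ e<a → <-≤-trans e<a a≤s) c<a

reading-action : ∀ {Above : Fin n → Set} → WellFormed Above T → (∀ {a} → Above a → All (_< a) c) →
                 reading T ·ₗ c ≡ c ++ firstColumnList T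
reading-action {c = c} [] _ = sym (++-identityʳ c)
reading-action {T = (a ∷ R) ∷ T} {c} (row Ar aR↑ T⋆) c<Above = begin
  (reading T ++ a ∷ R) ·ₗ c           ≡⟨ ·ₗ-++ (reading T) ⟩
  reading T ·ₗ ((a ∷ R) ·ₗ c)         ≡⟨ cong (reading T ·ₗ_) (row-action aR↑ (c<Above Ar)) ⟩
  reading T ·ₗ (c ++ [ a ])           ≡⟨ reading-action T⋆ ca<Above ⟩
  (c ++ [ a ]) ++ firstColumnList T   ≡⟨ ++-assoc c [ a ] (firstColumnList T) ⟩
  c ++ a ∷ firstColumnList T          ∎
  where
  open ≡-Reasoning
  ca<Above : ∀ {a′} → a < a′ → All (_< a′) (c ++ [ a ])
  ca<Above a<a′ = ++⁺ (All.map (λ e<a → <-trans e<a a<a′) (c<Above Ar)) (a<a′ ∷ [])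

firstColumnList-P : ∀ (u : Word n) → firstColumnList (P u) ≡ u ·ₗ []
firstColumnList-P u = begin
  firstColumnList (P u) ≡⟨ reading-action (insertWord-wellFormed u []) (λ _ → []) ⟨
  reading (P u) ·ₗ []   ≡⟨ same-action (insertWord-reading u []) [] ⟨
  u ·ₗ []               ∎
  where open ≡-Reasoning

-- Columns as sets

toSet : List (Fin n) → Subset n
toSet = foldr (λ h S → ⁅ h ⁆ ∪ S) ⊥

∈-toSet⁺ : ∀ {e : Fin n} c → e ∈ c → e ∈ₛ toSet c
∈-toSet⁺ (h ∷ c) (here refl) = x∈p∪q⁺ (inj₁ (x∈⁅x⁆ h))
∈-toSet⁺ (h ∷ c) (there e∈c) = x∈p∪q⁺ (inj₂ (∈-toSet⁺ c e∈c))

∈-toSet⁻ : ∀ {e : Fin n} c → e ∈ₛ toSet c → e ∈ c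
∈-toSet⁻ []      e∈ = contradiction e∈ ∉⊥
∈-toSet⁻ (h ∷ c) e∈ with x∈p∪q⁻ ⁅ h ⁆ (toSet c) e∈
... | inj₁ e∈h = here (x∈⁅y⁆⇒x≡y h e∈h)
... | inj₂ e∈c = there (∈-toSet⁻ c e∈c)

toSet-≡ : ∀ (c : List (Fin n)) → (∀ {i} → i ∈ c → i ∈ₛ S) → (∀ {i} → i ∈ₛ S → i ∈ c) →
          toSet c ≡ S
toSet-≡ c c⊆S S⊆c = ⊆-antisym (c⊆S ∘ ∈-toSet⁻ c) (∈-toSet⁺ c ∘ S⊆c)

toSet-firstColumnList : ∀ (T : Tableau n) → toSet (firstColumnList T) ≡ firstColumn T
toSet-firstColumnList []            = refl
toSet-firstColumnList ([] ∷ T)      = toSet-firstColumnList T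
toSet-firstColumnList ((a ∷ _) ∷ T) = cong (⁅ a ⁆ ∪_) (toSet-firstColumnList T)

x∉p-x : ∀ {i : Fin n} → ¬ (i ∈ₛ S - i)
x∉p-x {S = _ Vec.∷ _} {zero}  ()
x∉p-x {S = _ Vec.∷ _} {suc i} (Vec.there i∈) = x∉p-x i∈

toSet-snoc : ∀ c → toSet (c ++ [ x ]) ≡ toSet c ∪ ⁅ x ⁆
toSet-snoc {x = x} c = toSet-≡ (c ++ [ x ]) to from
  where
  to : ∀ {i} → i ∈ c ++ [ x ] → i ∈ₛ toSet c ∪ ⁅ x ⁆
  to i∈ with ∈-++⁻ c i∈
  ... | inj₁ i∈c         = x∈p∪q⁺ (inj₁ (∈-toSet⁺ c i∈c))
  ... | inj₂ (here refl) = x∈p∪q⁺ (inj₂ (x∈⁅x⁆ x))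
  from : ∀ {i} → i ∈ₛ toSet c ∪ ⁅ x ⁆ → i ∈ c ++ [ x ]
  from i∈ with x∈p∪q⁻ (toSet c) ⁅ x ⁆ i∈
  ... | inj₁ i∈c = ∈-++⁺ˡ (∈-toSet⁻ c i∈c)
  ... | inj₂ i∈x = ∈-++⁺ʳ c (here (x∈⁅y⁆⇒x≡y x i∈x))

toSet-replace : ∀ p → y ∉ p → y ∉ q → toSet (p ++ x ∷ q) ≡ (toSet (p ++ y ∷ q) - y) ∪ ⁅ x ⁆
toSet-replace {y = y} {q} {x} p y∉p y∉q = toSet-≡ (p ++ x ∷ q) to from
  where
  old = toSet (p ++ y ∷ q)
  kept : ∀ {i} → i ∈ p ++ y ∷ q → i ≢ y → i ∈ₛ (old - y) ∪ ⁅ x ⁆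
  kept i∈ i≢y = x∈p∪q⁺ (inj₁ (x∈p∧x≢y⇒x∈p-y (∈-toSet⁺ (p ++ y ∷ q) i∈) i≢y))
  to : ∀ {i} → i ∈ p ++ x ∷ q → i ∈ₛ (old - y) ∪ ⁅ x ⁆
  to i∈ with ∈-++⁻ p i∈
  ... | inj₁ i∈p         = kept (∈-++⁺ˡ i∈p) λ { refl → y∉p i∈p }
  ... | inj₂ (here refl) = x∈p∪q⁺ (inj₂ (x∈⁅x⁆ x))
  ... | inj₂ (there i∈q) = kept (∈-++⁺ʳ p (there i∈q)) λ { refl → y∉q i∈q }
  from : ∀ {i} → i ∈ₛ (old - y) ∪ ⁅ x ⁆ → i ∈ p ++ x ∷ q
  from i∈ with x∈p∪q⁻ (old - y) ⁅ x ⁆ i∈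
  ... | inj₂ i∈x = ∈-++⁺ʳ p (here (x∈⁅y⁆⇒x≡y x i∈x))
  ... | inj₁ i∈old-y with ∈-++⁻ p (∈-toSet⁻ (p ++ y ∷ q) (p─q⊆p old ⁅ y ⁆ i∈old-y))
  ...   | inj₁ i∈p         = ∈-++⁺ˡ i∈p
  ...   | inj₂ (here refl) = contradiction i∈old-y x∉p-x
  ...   | inj₂ (there i∈q) = ∈-++⁺ʳ p (there i∈q)

filter-minimum : ∀ {Q : Fin n → Set} (Q? : Decidable Q) {L} → Increasing L → z ∈ L → Q z →
                 (∀ {y} → y ∈ L → Q y → z ≤ y) → ∃ λ t → filter Q? L ≡ z ∷ t
filter-minimum Q? {_ ∷ L} _          (here refl) Qz _     = filter Q? L , filter-accept Q? Qz
filter-minimum Q? {h ∷ _} (h<L ∷ L↑) (there z∈L) Qz least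
  with filter-minimum Q? L↑ z∈L Qz (least ∘ there)
... | t , eq = t , trans (filter-reject Q? ¬Qh) eq
  where ¬Qh = λ Qh → ≤⇒≯ (least (here refl) Qh) (All.lookup h<L z∈L)

act-below : (∀ {i} → i ∈ₛ S → i < x) → act x S ≡ S ∪ ⁅ x ⁆
act-below {S = S} {x = x} S<x
  rewrite filter-none (λ y → (y ∈? S) ×-dec (x ≤? y)) {xs = allFin _}
            (All.tabulate λ _ (y∈S , x≤y) → ≤⇒≯ x≤y (S<x y∈S)) = refl

act-replace-least : y ∈ₛ S → x ≤ y → (∀ {i} → i ∈ₛ S → x ≤ i → y ≤ i) →
                    act x S ≡ (S - y) ∪ ⁅ x ⁆
act-replace-least {y = y} {S} {x} y∈S x≤y least
  with filter-minimum (λ i → (i ∈? S) ×-dec (x ≤? i)) allFin-increasing (∈-allFin y) (y∈S , x≤y)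
         (λ _ (i∈S , x≤i) → least i∈S x≤i)
... | _ , eq rewrite eq = refl

toSet-actList : Increasing c → toSet (actList x c) ≡ act x (toSet c)
toSet-actList {c = c} {x = x} c↑ with split (λ h → swap (≤-or-> x h)) c
... | all c<x = begin
  toSet (actList x c) ≡⟨ cong toSet (actList-append c<x) ⟩
  toSet (c ++ [ x ])  ≡⟨ toSet-snoc c ⟩
  toSet c ∪ ⁅ x ⁆     ≡⟨ act-below (All.lookup c<x ∘ ∈-toSet⁻ c) ⟨
  act x (toSet c)     ∎
  where open ≡-Reasoning
... | at p y q refl p<x x≤y = begin
  toSet (actList x (p ++ y ∷ q))   ≡⟨ cong toSet (actList-replace p p<x x≤y) ⟩
  toSet (p ++ x ∷ q)               ≡⟨ toSet-replace p y∉p y∉q ⟩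
  (toSet (p ++ y ∷ q) - y) ∪ ⁅ x ⁆ ≡⟨ act-replace-least y∈ x≤y least ⟨
  act x (toSet (p ++ y ∷ q))       ∎
  where
  open ≡-Reasoning
  y∈ = ∈-toSet⁺ (p ++ y ∷ q) (∈-++⁺ʳ p (here refl))
  y<q : All (y <_) q
  y<q with allPairs-++⁻ p c↑
  ... | _ , y<q ∷ _ , _ = y<q
  y∉p : y ∉ p
  y∉p y∈p = ≤⇒≯ x≤y (All.lookup p<x y∈p)
  y∉q : y ∉ q
  y∉q y∈q = <-irrefl refl (All.lookup y<q y∈q)
  least : ∀ {i} → i ∈ₛ toSet (p ++ y ∷ q) → x ≤ i → y ≤ i
  least i∈ x≤i with ∈-++⁻ p (∈-toSet⁻ (p ++ y ∷ q) i∈)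
  ... | inj₁ i∈p         = contradiction (All.lookup p<x i∈p) (≤⇒≯ x≤i)
  ... | inj₂ (here refl) = ≤-refl
  ... | inj₂ (there i∈q) = <⇒≤ (All.lookup y<q i∈q)

·ₗ-toSet : ∀ w → Increasing c → toSet (w ·ₗ c) ≡ w · toSet c
·ₗ-toSet []      c↑ = refl
·ₗ-toSet (x ∷ w) c↑ = trans (toSet-actList (·ₗ-increasing w c↑)) (cong (act x) (·ₗ-toSet w c↑))

reverse-·ₗ : ∀ L → Increasing (c ++ L) → reverse L ·ₗ c ≡ c ++ L
reverse-·ₗ {c = c} []      _   = sym (++-identityʳ c)
reverse-·ₗ {c = c} (y ∷ L) cL↑ = begin
  reverse (y ∷ L) ·ₗ c      ≡⟨ cong (_·ₗ c) (unfold-reverse y L) ⟩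
  (reverse L ++ [ y ]) ·ₗ c ≡⟨ ·ₗ-++ (reverse L) ⟩
  reverse L ·ₗ actList y c  ≡⟨ cong (reverse L ·ₗ_) (actList-append c<y) ⟩
  reverse L ·ₗ (c ++ [ y ]) ≡⟨ reverse-·ₗ L (subst Increasing (sym (++-assoc c [ y ] L)) cL↑) ⟩
  (c ++ [ y ]) ++ L         ≡⟨ ++-assoc c [ y ] L ⟩
  c ++ y ∷ L                ∎
  where
  open ≡-Reasoning
  c<y = All.map All.head (proj₂ (proj₂ (allPairs-++⁻ c cL↑)))

elemsInc-increasing : ∀ (γ : Column n) → Increasing (elemsInc γ)
elemsInc-increasing γ = AllPairs.filter⁺ (λ y → y ∈? γ) allFin-increasing

toSet-elemsInc : ∀ (γ : Column n) → toSet (elemsInc γ) ≡ γ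
toSet-elemsInc γ = toSet-≡ (elemsInc γ)
  (λ i∈ → proj₂ (∈-filter⁻ (λ y → y ∈? γ) {xs = allFin _} i∈))
  (λ {i} i∈γ → ∈-filter⁺ (λ y → y ∈? γ) (∈-allFin i) i∈γ)

r-·ₗ-[] : ∀ (γ : Column n) → r γ ·ₗ [] ≡ elemsInc γ
r-·ₗ-[] γ = reverse-·ₗ (elemsInc γ) (elemsInc-increasing γ)

firstColumn-P : ∀ (u : Word n) → firstColumn (P u) ≡ toSet (u ·ₗ [])
firstColumn-P u = trans (sym (toSet-firstColumnList (P u))) (cong toSet (firstColumnList-P u))

proposition4p1 : ∀ {n : ℕ} (γ : Column n) (w : Word n) →
    (w · γ ≡ firstColumn (P (w ++ r γ))) × (P (w ++ r γ) ≡ insertWord (r γ) (P w))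
proposition4p1 γ w = column , foldl-++ (λ T x → insert x T) [] w (r γ)
  where
  open ≡-Reasoning
  column : w · γ ≡ firstColumn (P (w ++ r γ))
  column = sym (begin
    firstColumn (P (w ++ r γ)) ≡⟨ firstColumn-P (w ++ r γ) ⟩
    toSet ((w ++ r γ) ·ₗ [])   ≡⟨ cong toSet (·ₗ-++ w) ⟩
    toSet (w ·ₗ r γ ·ₗ [])     ≡⟨ cong (λ c → toSet (w ·ₗ c)) (r-·ₗ-[] γ) ⟩
    toSet (w ·ₗ elemsInc γ)    ≡⟨ ·ₗ-toSet w (elemsInc-increasing γ) ⟩
    w · toSet (elemsInc γ)     ≡⟨ cong (w ·_) (toSet-elemsInc γ) ⟩
    w · γ                      ∎)
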